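{- The number of pairwise nonequivalent graphical Hadamard matrices of order $4^m$ is unbounded as $m$ ranges over the positive integers; that is, for every $N$ there exists $m$ such that there are at least $N$ pairwise nonequivalent graphical Hadamard matrices of order $4^m$.
   Context: A Hadamard matrix of order $n$ is an $n\times n$ matrix $H$ with entries $\pm1$ satisfying $HH^{\top}=nI$. It is graphical if it is symmetric and has constant diagonal. Two Hadamard matrices are equivalent if one can be obtained from the other by permuting rows, permuting columns, and multiplying rows and columns by $-1$. -}

module Defs where

open import Data.Nat using (ℕ; suc)
open import Data.Integer using (ℤ; +_; -[1+_]; _*_; _+_)
open import Data.Fin using (Fin)
open import Data.Product using (Σ; _×_; ∃)
open import Data.Sum using (_⊎_)
open import Relation.Binary.PropositionalEquality using (_≡_; _≢_)
open import Relation.Nullary using (¬_)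
open import Function.Bundles using (_↔_; Inverse)
open import Data.Vec.Functional using (foldr)

Matrix : ℕ → Set
Matrix n = Fin n → Fin n → ℤ

IsSign : ℤ → Set
IsSign x = (x ≡ + 1) ⊎ (x ≡ -[1+ 0 ])

∑ : {n : ℕ} → (Fin n → ℤ) → ℤ
∑ f = foldr _+_ (+ 0) f

scaledId : (n : ℕ) → Fin n → Fin n → ℤ → Set
scaledId n i j x = ((i ≡ j) → x ≡ + n) × ((i ≢ j) → x ≡ + 0)

IsHadamard : (n : ℕ) → Matrix n → Set
IsHadamard n H =
  ((i j : Fin n) → IsSign (H i j)) ×
  ((i j : Fin n) → scaledId n i j (∑ (λ k → H i k * H j k)))

IsSymmetric : {n : ℕ} → Matrix n → Set
IsSymmetric H = ∀ i j → H i j ≡ H j i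

ConstantDiagonal : {n : ℕ} → Matrix n → Set
ConstantDiagonal H = ∀ i j → H i i ≡ H j j

IsGraphicalHadamard : (n : ℕ) → Matrix n → Set
IsGraphicalHadamard n H = IsHadamard n H × IsSymmetric H × ConstantDiagonal H

Equivalent : (n : ℕ) → Matrix n → Matrix n → Set
Equivalent n H H' =
  Σ (Fin n ↔ Fin n) λ σ → Σ (Fin n ↔ Fin n) λ τ →
  Σ (Fin n → ℤ) λ r → Σ (Fin n → ℤ) λ c →
    ((i : Fin n) → IsSign (r i)) × ((j : Fin n) → IsSign (c j)) ×
    ((i j : Fin n) →
      H' i j ≡ r i * c j * H (Inverse.to σ i) (Inverse.to τ j))

-- For a ±1 matrix H and even k, the profile moment
--   Σ over k-tuples (i₁ … i_k) of rows of (Σ_l H i₁ l ⋯ H i_k l) ^ k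
-- is an equivalence invariant: row and column permutations permute the tuples and the
-- columns, and all sign changes disappear in even powers. It is multiplicative under the
-- Kronecker product and, since the exponent equals the tuple length, unchanged by
-- transposition. For a Hadamard matrix M the matrix with entries M(i₁,j₂) M(j₁,i₂) is a
-- column permutation of M ⊗ Mᵀ, hence a graphical Hadamard matrix whose moment is the
-- square of that of M. Starting from a Hadamard matrix M₁₆ that is not of Sylvester type
-- and from the Sylvester matrix C₄ ⊗ C₄ this gives graphical A, B of order 256 with fourth
-- moments a < b, and the Kronecker words A^k ⊗ B^(N-k), k < N, are graphical Hadamard
-- matrices of order 256^N with the pairwise distinct moments a^k b^(N-k).

module Submission where

open import Defs
open import Data.Nat as ℕ using (ℕ; zero; suc; _^_; _<_; _≤_; s≤s; NonZero)
import Data.Nat.Properties as ℕP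
open import Data.Integer as ℤ using (ℤ; +_; -[1+_]; _*_; _+_)
import Data.Integer.Properties as ℤP
open import Data.Fin using (Fin; zero; suc; _↑ˡ_; _↑ʳ_; combine; quotient; remainder; toℕ)
open import Data.Fin.Properties using (remQuot-combine; combine-remQuot; combine-injective; toℕ-injective; toℕ<n; all?)
  renaming (_≟_ to _≟ᶠ_)
open import Data.Vec using (Vec; []; _∷_; map; zipWith; lookup)
open import Data.Nat.Divisibility using (_∣_; divides)
open import Data.Product using (Σ; _×_; _,_; proj₁; proj₂)
open import Data.Sum using (inj₁; inj₂)
open import Data.Empty using (⊥-elim)
open import Function using (_∘_)
open import Function.Bundles using (_↔_; Inverse; mk↔ₛ′)
open import Function.Construct.Identity using (↔-id)
open import Relation.Binary using (tri<; tri≈; tri>)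
open import Relation.Binary.PropositionalEquality
open import Relation.Nullary using (¬_; Dec; yes; no; does)
open import Relation.Nullary.Decidable using (map′; _×-dec_; _⊎-dec_; toWitness)
open import Data.Bool using (if_then_else_)
open import Algebra.Properties.Semiring.Sum ℤP.+-*-semiring
  using (sum-cong-≗; *-distribˡ-sum; *-distribʳ-sum; ∑-comm; ∑-permute)
open import Algebra.Properties.CommutativeSemigroup ℤP.*-commutativeSemigroup
  using (interchange)

open ≡-Reasoning

∑-*-∑ : ∀ {m n} (f : Fin m → ℤ) (g : Fin n → ℤ) → ∑ f * ∑ g ≡ ∑ λ i → ∑ λ j → f i * g j
∑-*-∑ f g = trans (*-distribʳ-sum (∑ g) f) (sum-cong-≗ λ i → *-distribˡ-sum (f i) g)

∑-↑ : ∀ {m n} (f : Fin (m ℕ.+ n) → ℤ) → ∑ f ≡ ∑ (λ i → f (i ↑ˡ n)) + ∑ (λ j → f (m ↑ʳ j))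
∑-↑ {zero} f = sym (ℤP.+-identityˡ (∑ f))
∑-↑ {suc m} {n} f = begin
  f zero + ∑ (f ∘ suc)                                              ≡⟨ cong (_+_ (f zero)) (∑-↑ {m} (f ∘ suc)) ⟩
  f zero + (∑ (λ i → f (suc (i ↑ˡ n))) + ∑ (λ j → f (suc (m ↑ʳ j)))) ≡⟨ ℤP.+-assoc (f zero) _ _ ⟨
  f zero + ∑ (λ i → f (suc (i ↑ˡ n))) + ∑ (λ j → f (suc (m ↑ʳ j)))   ∎

∑-combine : ∀ {m n} (f : Fin (m ℕ.* n) → ℤ) → ∑ f ≡ ∑ λ (i : Fin m) → ∑ λ (j : Fin n) → f (combine i j)
∑-combine {zero} f = refl
∑-combine {suc m} {n} f =
  trans (∑-↑ {n} f) (cong (_+_ (∑ (λ j → f (j ↑ˡ m ℕ.* n)))) (∑-combine {m} {n} (λ k → f (n ↑ʳ k))))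

∑-↔ : ∀ {n} (σ : Fin n ↔ Fin n) (f : Fin n → ℤ) → ∑ (f ∘ Inverse.to σ) ≡ ∑ f
∑-↔ σ f = sym (∑-permute f σ)

∑ᵛ : ∀ {n} k → (Vec (Fin n) k → ℤ) → ℤ
∑ᵛ zero F = F []
∑ᵛ (suc k) F = ∑ λ i → ∑ᵛ k (λ is → F (i ∷ is))

∏ᵛ : ∀ {n k} → (Fin n → ℤ) → Vec (Fin n) k → ℤ
∏ᵛ f [] = + 1
∏ᵛ f (i ∷ is) = f i * ∏ᵛ f is

∑ᵛ-cong : ∀ {n} k {F G : Vec (Fin n) k → ℤ} → (∀ is → F is ≡ G is) → ∑ᵛ k F ≡ ∑ᵛ k G
∑ᵛ-cong zero F≗G = F≗G []
∑ᵛ-cong (suc k) F≗G = sum-cong-≗ λ i → ∑ᵛ-cong k (λ is → F≗G (i ∷ is))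

∑ᵛ-*ˡ : ∀ {n} k c (F : Vec (Fin n) k → ℤ) → c * ∑ᵛ k F ≡ ∑ᵛ k (λ is → c * F is)
∑ᵛ-*ˡ zero c F = refl
∑ᵛ-*ˡ (suc k) c F =
  trans (*-distribˡ-sum c (λ i → ∑ᵛ k λ is → F (i ∷ is))) (sum-cong-≗ λ i → ∑ᵛ-*ˡ k c (λ is → F (i ∷ is)))

∑ᵛ-*-∑ᵛ : ∀ {m n} k l (F : Vec (Fin m) k → ℤ) (G : Vec (Fin n) l → ℤ) →
  ∑ᵛ k F * ∑ᵛ l G ≡ ∑ᵛ k λ is → ∑ᵛ l λ js → F is * G js
∑ᵛ-*-∑ᵛ zero l F G = ∑ᵛ-*ˡ l (F []) G
∑ᵛ-*-∑ᵛ (suc k) l F G =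
  trans (*-distribʳ-sum (∑ᵛ l G) (λ i → ∑ᵛ k λ is → F (i ∷ is))) (sum-cong-≗ λ i → ∑ᵛ-*-∑ᵛ k l (λ is → F (i ∷ is)) G)

∑-∑ᵛ-comm : ∀ {m n} k (F : Fin m → Vec (Fin n) k → ℤ) →
  ∑ (λ i → ∑ᵛ k (F i)) ≡ ∑ᵛ k (λ is → ∑ λ i → F i is)
∑-∑ᵛ-comm zero F = refl
∑-∑ᵛ-comm (suc k) F =
  trans (∑-comm (λ i j → ∑ᵛ k λ is → F i (j ∷ is))) (sum-cong-≗ λ j → ∑-∑ᵛ-comm k (λ i is → F i (j ∷ is)))

∑ᵛ-comm : ∀ {m n} k l (F : Vec (Fin m) k → Vec (Fin n) l → ℤ) →
  ∑ᵛ k (λ is → ∑ᵛ l (F is)) ≡ ∑ᵛ l (λ js → ∑ᵛ k λ is → F is js)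
∑ᵛ-comm zero l F = refl
∑ᵛ-comm (suc k) l F = begin
  ∑ (λ i → ∑ᵛ k λ is → ∑ᵛ l (F (i ∷ is)))   ≡⟨ sum-cong-≗ (λ i → ∑ᵛ-comm k l (λ is → F (i ∷ is))) ⟩
  ∑ (λ i → ∑ᵛ l λ js → ∑ᵛ k λ is → F (i ∷ is) js) ≡⟨ ∑-∑ᵛ-comm l (λ i js → ∑ᵛ k λ is → F (i ∷ is) js) ⟩
  ∑ᵛ l (λ js → ∑ λ i → ∑ᵛ k λ is → F (i ∷ is) js) ∎

∑ᵛ-combine : ∀ {m n} k (F : Vec (Fin (m ℕ.* n)) k → ℤ) →
  ∑ᵛ k F ≡ ∑ᵛ k λ (is : Vec (Fin m) k) → ∑ᵛ k λ (js : Vec (Fin n) k) → F (zipWith combine is js)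
∑ᵛ-combine zero F = refl
∑ᵛ-combine {m} {n} (suc k) F = begin
  ∑ (λ I → ∑ᵛ k λ Is → F (I ∷ Is))
    ≡⟨ sum-cong-≗ (λ I → ∑ᵛ-combine {m} {n} k (λ Is → F (I ∷ Is))) ⟩
  ∑ (λ I → ∑ᵛ k λ is → ∑ᵛ k λ js → F (I ∷ zipWith combine is js))
    ≡⟨ ∑-combine {m} {n} _ ⟩
  ∑ (λ i → ∑ λ j → ∑ᵛ k λ is → ∑ᵛ k (G i j is))
    ≡⟨ sum-cong-≗ (λ i → ∑-∑ᵛ-comm k (λ j is → ∑ᵛ k (G i j is))) ⟩
  ∑ (λ i → ∑ᵛ k λ is → ∑ λ j → ∑ᵛ k (G i j is))     ∎
  where
  G : Fin m → Fin n → Vec (Fin m) k → Vec (Fin n) k → ℤ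
  G i j is js = F (combine i j ∷ zipWith combine is js)

∑ᵛ-↔ : ∀ {n} k (σ : Fin n ↔ Fin n) (F : Vec (Fin n) k → ℤ) →
  ∑ᵛ k (F ∘ map (Inverse.to σ)) ≡ ∑ᵛ k F
∑ᵛ-↔ zero σ F = refl
∑ᵛ-↔ (suc k) σ F =
  trans (sum-cong-≗ λ i → ∑ᵛ-↔ k σ (λ is → F (Inverse.to σ i ∷ is)))
        (∑-↔ σ (λ i → ∑ᵛ k λ is → F (i ∷ is)))

∑-^ : ∀ {n} (f : Fin n → ℤ) k → ∑ f ℤ.^ k ≡ ∑ᵛ k (∏ᵛ f)
∑-^ f zero = refl
∑-^ f (suc k) = begin
  ∑ f * ∑ f ℤ.^ k                       ≡⟨ cong (∑ f *_) (∑-^ f k) ⟩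
  ∑ f * ∑ᵛ k (∏ᵛ f)                     ≡⟨ *-distribʳ-sum (∑ᵛ k (∏ᵛ f)) f ⟩
  ∑ (λ i → f i * ∑ᵛ k (∏ᵛ f))            ≡⟨ sum-cong-≗ (λ i → ∑ᵛ-*ˡ k (f i) (∏ᵛ f)) ⟩
  ∑ (λ i → ∑ᵛ k λ is → f i * ∏ᵛ f is)   ∎

∏ᵛ-cong : ∀ {n k} {f g : Fin n → ℤ} → (∀ i → f i ≡ g i) → (is : Vec (Fin n) k) → ∏ᵛ f is ≡ ∏ᵛ g is
∏ᵛ-cong f≗g [] = refl
∏ᵛ-cong f≗g (i ∷ is) = cong₂ _*_ (f≗g i) (∏ᵛ-cong f≗g is)

∏ᵛ-* : ∀ {n k} (f g : Fin n → ℤ) (is : Vec (Fin n) k) →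
  ∏ᵛ (λ i → f i * g i) is ≡ ∏ᵛ f is * ∏ᵛ g is
∏ᵛ-* f g [] = refl
∏ᵛ-* f g (i ∷ is) =
  trans (cong (f i * g i *_) (∏ᵛ-* f g is)) (interchange (f i) (g i) (∏ᵛ f is) (∏ᵛ g is))

∏ᵛ-const : ∀ {n k} c (is : Vec (Fin n) k) → ∏ᵛ (λ _ → c) is ≡ c ℤ.^ k
∏ᵛ-const c [] = refl
∏ᵛ-const c (i ∷ is) = cong (c *_) (∏ᵛ-const c is)

∏ᵛ-map : ∀ {n k} (σ : Fin n → Fin n) (f : Fin n → ℤ) (is : Vec (Fin n) k) →
  ∏ᵛ f (map σ is) ≡ ∏ᵛ (f ∘ σ) is
∏ᵛ-map σ f [] = refl
∏ᵛ-map σ f (i ∷ is) = cong (f (σ i) *_) (∏ᵛ-map σ f is)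

∏ᵛ-comm : ∀ {m n k l} (F : Fin m → Fin n → ℤ) (is : Vec (Fin m) k) (js : Vec (Fin n) l) →
  ∏ᵛ (λ i → ∏ᵛ (F i) js) is ≡ ∏ᵛ (λ j → ∏ᵛ (λ i → F i j) is) js
∏ᵛ-comm {l = l} F [] js = sym (trans (∏ᵛ-const (+ 1) js) (ℤP.^-zeroˡ l))
∏ᵛ-comm F (i ∷ is) js =
  trans (cong (∏ᵛ (F i) js *_) (∏ᵛ-comm F is js)) (sym (∏ᵛ-* (F i) _ js))

sign-* : ∀ {x y} → IsSign x → IsSign y → IsSign (x * y)
sign-* (inj₁ refl) (inj₁ refl) = inj₁ refl
sign-* (inj₁ refl) (inj₂ refl) = inj₂ refl
sign-* (inj₂ refl) (inj₁ refl) = inj₂ refl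
sign-* (inj₂ refl) (inj₂ refl) = inj₁ refl

sign-square : ∀ {x} → IsSign x → x * x ≡ + 1
sign-square (inj₁ refl) = refl
sign-square (inj₂ refl) = refl

sign-^ : ∀ {x} → IsSign x → ∀ q → IsSign (x ℤ.^ q)
sign-^ x-sign zero    = inj₁ refl
sign-^ x-sign (suc q) = sign-* x-sign (sign-^ x-sign q)

sign-^-even : ∀ {x k} → IsSign x → 2 ∣ k → x ℤ.^ k ≡ + 1
sign-^-even {x} x-sign (divides q refl) = begin
  x ℤ.^ (q ℕ.* 2)            ≡⟨ ℤP.^-*-assoc x q 2 ⟨
  x ℤ.^ q * (x ℤ.^ q * + 1)  ≡⟨ cong (x ℤ.^ q *_) (ℤP.*-identityʳ (x ℤ.^ q)) ⟩
  x ℤ.^ q * x ℤ.^ q          ≡⟨ sign-square (sign-^ x-sign q) ⟩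
  + 1                        ∎

^-distrib-* : ∀ x y k → (x * y) ℤ.^ k ≡ x ℤ.^ k * y ℤ.^ k
^-distrib-* x y zero = refl
^-distrib-* x y (suc k) =
  trans (cong (x * y *_) (^-distrib-* x y k)) (interchange x y (x ℤ.^ k) (y ℤ.^ k))

∏ᵛ-sign : ∀ {n k} {f : Fin n → ℤ} → (∀ i → IsSign (f i)) → (is : Vec (Fin n) k) → IsSign (∏ᵛ f is)
∏ᵛ-sign f-sign [] = inj₁ refl
∏ᵛ-sign f-sign (i ∷ is) = sign-* (f-sign i) (∏ᵛ-sign f-sign is)

transpose : ∀ {n} → Matrix n → Matrix n
transpose H i j = H j i

quotient-combine : ∀ {a b} (i : Fin a) (j : Fin b) → quotient b (combine i j) ≡ i
quotient-combine i j = cong proj₁ (remQuot-combine i j)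

remainder-combine : ∀ {a b} (i : Fin a) (j : Fin b) → remainder {a} b (combine i j) ≡ j
remainder-combine i j = cong proj₂ (remQuot-combine i j)

infixr 7 _⊗_

_⊗_ : ∀ {a b} → Matrix a → Matrix b → Matrix (a ℕ.* b)
_⊗_ {a} {b} A B i j =
  A (quotient {a} b i) (quotient {a} b j) * B (remainder {a} b i) (remainder {a} b j)

⊗-combine : ∀ {a b} (A : Matrix a) (B : Matrix b) i₁ i₂ j₁ j₂ →
  (A ⊗ B) (combine i₁ i₂) (combine j₁ j₂) ≡ A i₁ j₁ * B i₂ j₂
⊗-combine A B i₁ i₂ j₁ j₂ =
  cong₂ _*_ (cong₂ A (quotient-combine i₁ i₂) (quotient-combine j₁ j₂))
            (cong₂ B (remainder-combine i₁ i₂) (remainder-combine j₁ j₂))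

∀-combine : ∀ {a b p} {P : Fin (a ℕ.* b) → Set p} → (∀ i j → P (combine i j)) → ∀ I → P I
∀-combine {a} {b} {P = P} P-combine I =
  subst P (combine-remQuot {a} b I) (P-combine (quotient {a} b I) (remainder {a} b I))

scaledId-* : ∀ {a b i₁ j₁ i₂ j₂ x y} → scaledId a i₁ j₁ x → scaledId b i₂ j₂ y →
  scaledId (a ℕ.* b) (combine i₁ i₂) (combine j₁ j₂) (x * y)
scaledId-* {a} {b} {i₁} {j₁} {i₂} {j₂} {x} {y} (x-diag , x-off) (y-diag , y-off) = diag , off
  where
  diag : combine i₁ i₂ ≡ combine j₁ j₂ → x * y ≡ + (a ℕ.* b)
  diag eq with combine-injective i₁ i₂ j₁ j₂ eq
  ... | refl , refl = trans (cong₂ _*_ (x-diag refl) (y-diag refl)) (sym (ℤP.pos-* a b))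
  off : combine i₁ i₂ ≢ combine j₁ j₂ → x * y ≡ + 0
  off neq with i₁ ≟ᶠ j₁
  ... | no i₁≢j₁ = trans (cong (_* y) (x-off i₁≢j₁)) (ℤP.*-zeroˡ y)
  ... | yes refl = trans (cong (x *_) (y-off λ i₂≡j₂ → neq (cong (combine i₁) i₂≡j₂))) (ℤP.*-zeroʳ x)

rowDot : ∀ {n} → Matrix n → Fin n → Fin n → ℤ
rowDot H i j = ∑ λ k → H i k * H j k

⊗-rowDot : ∀ {a b} (A : Matrix a) (B : Matrix b) i₁ i₂ j₁ j₂ →
  rowDot (A ⊗ B) (combine i₁ i₂) (combine j₁ j₂) ≡ rowDot A i₁ j₁ * rowDot B i₂ j₂
⊗-rowDot {a} {b} A B i₁ i₂ j₁ j₂ = begin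
  rowDot (A ⊗ B) (combine i₁ i₂) (combine j₁ j₂)
    ≡⟨ ∑-combine {a} {b} _ ⟩
  ∑ (λ (k₁ : Fin a) → ∑ λ (k₂ : Fin b) → (A ⊗ B) (combine i₁ i₂) (combine k₁ k₂) * (A ⊗ B) (combine j₁ j₂) (combine k₁ k₂))
    ≡⟨ sum-cong-≗ (λ k₁ → sum-cong-≗ λ k₂ → trans
         (cong₂ _*_ (⊗-combine A B i₁ i₂ k₁ k₂) (⊗-combine A B j₁ j₂ k₁ k₂))
         (interchange (A i₁ k₁) (B i₂ k₂) (A j₁ k₁) (B j₂ k₂))) ⟩
  ∑ (λ (k₁ : Fin a) → ∑ λ (k₂ : Fin b) → (A i₁ k₁ * A j₁ k₁) * (B i₂ k₂ * B j₂ k₂))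
    ≡⟨ ∑-*-∑ (λ k₁ → A i₁ k₁ * A j₁ k₁) (λ k₂ → B i₂ k₂ * B j₂ k₂) ⟨
  rowDot A i₁ j₁ * rowDot B i₂ j₂ ∎

⊗-isHadamard : ∀ {a b} {A : Matrix a} {B : Matrix b} →
  IsHadamard a A → IsHadamard b B → IsHadamard (a ℕ.* b) (A ⊗ B)
⊗-isHadamard {a} {b} {A} {B} (A-sign , A-orth) (B-sign , B-orth) =
  (λ i j → sign-* (A-sign _ _) (B-sign _ _)) ,
  ∀-combine {P = λ I → ∀ J → scaledId (a ℕ.* b) I J (rowDot (A ⊗ B) I J)} λ i₁ i₂ →
  ∀-combine λ j₁ j₂ →
    subst (scaledId (a ℕ.* b) (combine i₁ i₂) (combine j₁ j₂)) (sym (⊗-rowDot A B i₁ i₂ j₁ j₂))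
          (scaledId-* (A-orth i₁ j₁) (B-orth i₂ j₂))

⊗-isGraphicalHadamard : ∀ {a b} {A : Matrix a} {B : Matrix b} →
  IsGraphicalHadamard a A → IsGraphicalHadamard b B → IsGraphicalHadamard (a ℕ.* b) (A ⊗ B)
⊗-isGraphicalHadamard (A-had , A-sym , A-diag) (B-had , B-sym , B-diag) =
  ⊗-isHadamard A-had B-had ,
  (λ i j → cong₂ _*_ (A-sym _ _) (B-sym _ _)) ,
  (λ i j → cong₂ _*_ (A-diag _ _) (B-diag _ _))

isHadamard-permuteColumns : ∀ {n} {H : Matrix n} (τ : Fin n ↔ Fin n) →
  IsHadamard n H → IsHadamard n (λ i j → H i (Inverse.to τ j))
isHadamard-permuteColumns {n} {H} τ (H-sign , H-orth) =
  (λ i j → H-sign i _) ,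
  λ i j → subst (scaledId n i j) (sym (∑-↔ τ (λ k → H i k * H j k))) (H-orth i j)

innerProduct : ∀ {n k} → Matrix n → Vec (Fin n) k → ℤ
innerProduct H is = ∑ λ l → ∏ᵛ (λ i → H i l) is

profileMoment : ∀ {n} k → Matrix n → ℤ
profileMoment k H = ∑ᵛ k λ is → innerProduct H is ℤ.^ k

profileMoment-cong : ∀ {n} k {H H′ : Matrix n} → (∀ i j → H i j ≡ H′ i j) →
  profileMoment k H ≡ profileMoment k H′
profileMoment-cong k H≗H′ = ∑ᵛ-cong k λ is →
  cong (ℤ._^ k) (sum-cong-≗ λ l → ∏ᵛ-cong (λ i → H≗H′ i l) is)

∏ᵛ-⊗ : ∀ {a b k} (A : Matrix a) (B : Matrix b) (is : Vec (Fin a) k) (js : Vec (Fin b) k) l₁ l₂ →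
  ∏ᵛ (λ I → (A ⊗ B) I (combine l₁ l₂)) (zipWith combine is js) ≡
  ∏ᵛ (λ i → A i l₁) is * ∏ᵛ (λ j → B j l₂) js
∏ᵛ-⊗ A B [] [] l₁ l₂ = refl
∏ᵛ-⊗ A B (i ∷ is) (j ∷ js) l₁ l₂ =
  trans (cong₂ _*_ (⊗-combine A B i j l₁ l₂) (∏ᵛ-⊗ A B is js l₁ l₂))
        (interchange (A i l₁) (B j l₂) _ _)

innerProduct-⊗ : ∀ {a b k} (A : Matrix a) (B : Matrix b) (is : Vec (Fin a) k) (js : Vec (Fin b) k) →
  innerProduct (A ⊗ B) (zipWith combine is js) ≡ innerProduct A is * innerProduct B js
innerProduct-⊗ {a} {b} A B is js =
  trans (∑-combine {a} {b} _)
  (trans (sum-cong-≗ λ l₁ → sum-cong-≗ λ l₂ → ∏ᵛ-⊗ A B is js l₁ l₂)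
         (sym (∑-*-∑ (λ l₁ → ∏ᵛ (λ i → A i l₁) is) (λ l₂ → ∏ᵛ (λ j → B j l₂) js))))

profileMoment-⊗ : ∀ {a b} k (A : Matrix a) (B : Matrix b) →
  profileMoment k (A ⊗ B) ≡ profileMoment k A * profileMoment k B
profileMoment-⊗ {a} {b} k A B = begin
  profileMoment k (A ⊗ B)
    ≡⟨ ∑ᵛ-combine {a} {b} k _ ⟩
  ∑ᵛ k (λ is → ∑ᵛ k λ js → innerProduct (A ⊗ B) (zipWith combine is js) ℤ.^ k)
    ≡⟨ ∑ᵛ-cong k (λ is → ∑ᵛ-cong k λ js →
         trans (cong (ℤ._^ k) (innerProduct-⊗ A B is js)) (^-distrib-* _ _ k)) ⟩
  ∑ᵛ k (λ is → ∑ᵛ k λ js → innerProduct A is ℤ.^ k * innerProduct B js ℤ.^ k)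
    ≡⟨ ∑ᵛ-*-∑ᵛ k k _ _ ⟨
  profileMoment k A * profileMoment k B ∎

profileMoment-⊗-+ : ∀ {a b} k (A : Matrix a) (B : Matrix b) {x y} →
  profileMoment k A ≡ + x → profileMoment k B ≡ + y → profileMoment k (A ⊗ B) ≡ + (x ℕ.* y)
profileMoment-⊗-+ k A B {x} {y} A-m B-m =
  trans (profileMoment-⊗ k A B) (trans (cong₂ _*_ A-m B-m) (sym (ℤP.pos-* x y)))

profileMoment-transpose : ∀ {n} k (H : Matrix n) → profileMoment k (transpose H) ≡ profileMoment k H
profileMoment-transpose k H = begin
  ∑ᵛ k (λ is → (∑ λ l → ∏ᵛ (λ i → H l i) is) ℤ.^ k)
    ≡⟨ ∑ᵛ-cong k (λ is → ∑-^ _ k) ⟩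
  ∑ᵛ k (λ is → ∑ᵛ k λ ls → ∏ᵛ (λ l → ∏ᵛ (λ i → H l i) is) ls)
    ≡⟨ ∑ᵛ-comm k k _ ⟩
  ∑ᵛ k (λ ls → ∑ᵛ k λ is → ∏ᵛ (λ l → ∏ᵛ (λ i → H l i) is) ls)
    ≡⟨ ∑ᵛ-cong k (λ ls → ∑ᵛ-cong k λ is → ∏ᵛ-comm (λ i l → H l i) is ls) ⟨
  ∑ᵛ k (λ ls → ∑ᵛ k λ is → ∏ᵛ (λ i → ∏ᵛ (λ l → H l i) ls) is)
    ≡⟨ ∑ᵛ-cong k (λ ls → ∑-^ _ k) ⟨
  ∑ᵛ k (λ ls → (∑ λ i → ∏ᵛ (λ l → H l i) ls) ℤ.^ k) ∎

∏ᵛ-rescaled : ∀ {n k} (r h : Fin n → ℤ) c (is : Vec (Fin n) k) →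
  ∏ᵛ (λ i → r i * c * h i) is ≡ ∏ᵛ r is * c ℤ.^ k * ∏ᵛ h is
∏ᵛ-rescaled {k = k} r h c is = begin
  ∏ᵛ (λ i → r i * c * h i) is           ≡⟨ ∏ᵛ-* (λ i → r i * c) h is ⟩
  ∏ᵛ (λ i → r i * c) is * ∏ᵛ h is       ≡⟨ cong (_* ∏ᵛ h is) (∏ᵛ-* r (λ _ → c) is) ⟩
  ∏ᵛ r is * ∏ᵛ (λ _ → c) is * ∏ᵛ h is   ≡⟨ cong (λ x → ∏ᵛ r is * x * ∏ᵛ h is) (∏ᵛ-const c is) ⟩
  ∏ᵛ r is * c ℤ.^ k * ∏ᵛ h is           ∎

module _ {n} (H : Matrix n) (σ τ : Fin n ↔ Fin n) (r c : Fin n → ℤ) where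

  rescaled : Matrix n
  rescaled i j = r i * c j * H (Inverse.to σ i) (Inverse.to τ j)

  innerProduct-rescaled : ∀ {k} → 2 ∣ k → (∀ j → IsSign (c j)) → (is : Vec (Fin n) k) →
    innerProduct rescaled is ≡ ∏ᵛ r is * innerProduct H (map (Inverse.to σ) is)
  innerProduct-rescaled {k} 2∣k c-sign is = begin
    ∑ (λ l → ∏ᵛ (λ i → r i * c l * H (σ′ i) (τ′ l)) is)
      ≡⟨ sum-cong-≗ (λ l → ∏ᵛ-rescaled r (λ i → H (σ′ i) (τ′ l)) (c l) is) ⟩
    ∑ (λ l → ∏ᵛ r is * c l ℤ.^ k * ∏ᵛ (λ i → H (σ′ i) (τ′ l)) is)
      ≡⟨ sum-cong-≗ (λ l → cong₂ _*_
           (trans (cong (∏ᵛ r is *_) (sign-^-even (c-sign l) 2∣k)) (ℤP.*-identityʳ (∏ᵛ r is)))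
           (sym (∏ᵛ-map σ′ (λ i → H i (τ′ l)) is))) ⟩
    ∑ (λ l → ∏ᵛ r is * P (τ′ l))
      ≡⟨ *-distribˡ-sum (∏ᵛ r is) (P ∘ τ′) ⟨
    ∏ᵛ r is * ∑ (P ∘ τ′)
      ≡⟨ cong (∏ᵛ r is *_) (∑-↔ τ P) ⟩
    ∏ᵛ r is * ∑ P ∎
    where
    σ′ = Inverse.to σ
    τ′ = Inverse.to τ
    P : Fin n → ℤ
    P l = ∏ᵛ (λ i → H i l) (map σ′ is)

profileMoment-equivalent : ∀ {k n} {H H′ : Matrix n} → 2 ∣ k → Equivalent n H H′ →
  profileMoment k H′ ≡ profileMoment k H
profileMoment-equivalent {k} {H = H} {H′} 2∣k (σ , τ , r , c , r-sign , c-sign , H′≡) = begin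
  profileMoment k H′
    ≡⟨ profileMoment-cong k H′≡ ⟩
  ∑ᵛ k (λ is → innerProduct (rescaled H σ τ r c) is ℤ.^ k)
    ≡⟨ ∑ᵛ-cong k (λ is → cong (ℤ._^ k) (innerProduct-rescaled H σ τ r c 2∣k c-sign is)) ⟩
  ∑ᵛ k (λ is → (∏ᵛ r is * innerProduct H (map σ′ is)) ℤ.^ k)
    ≡⟨ ∑ᵛ-cong k (λ is → trans (^-distrib-* (∏ᵛ r is) _ k)
         (trans (cong (_* innerProduct H (map σ′ is) ℤ.^ k) (sign-^-even (∏ᵛ-sign r-sign is) 2∣k))
                (ℤP.*-identityˡ (innerProduct H (map σ′ is) ℤ.^ k)))) ⟩
  ∑ᵛ k (λ is → innerProduct H (map σ′ is) ℤ.^ k)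
    ≡⟨ ∑ᵛ-↔ k σ (λ is → innerProduct H is ℤ.^ k) ⟩
  profileMoment k H ∎
  where
  σ′ = Inverse.to σ

module _ {n : ℕ} where

  swapFactors : Fin (n ℕ.* n) → Fin (n ℕ.* n)
  swapFactors i = combine (remainder {n} n i) (quotient {n} n i)

  swapFactors-involutive : ∀ i → swapFactors (swapFactors i) ≡ i
  swapFactors-involutive i =
    trans (cong₂ combine (remainder-combine (remainder {n} n i) (quotient {n} n i))
                         (quotient-combine (remainder {n} n i) (quotient {n} n i)))
          (combine-remQuot {n} n i)

  swapFactors↔ : Fin (n ℕ.* n) ↔ Fin (n ℕ.* n)
  swapFactors↔ = mk↔ₛ′ swapFactors swapFactors swapFactors-involutive swapFactors-involutive

  graphicalSquare : Matrix n → Matrix (n ℕ.* n)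
  graphicalSquare M i j = (M ⊗ transpose M) i (swapFactors j)

  graphicalSquare-entry : ∀ (M : Matrix n) i j →
    graphicalSquare M i j ≡ M (quotient n i) (remainder {n} n j) * M (quotient n j) (remainder {n} n i)
  graphicalSquare-entry M i j =
    cong₂ (λ u v → M (quotient n i) u * M v (remainder {n} n i))
          (quotient-combine (remainder {n} n j) (quotient {n} n j))
          (remainder-combine (remainder {n} n j) (quotient {n} n j))

  graphicalSquare-isGraphicalHadamard : ∀ (M : Matrix n) →
    IsHadamard n M → IsHadamard n (transpose M) → IsGraphicalHadamard (n ℕ.* n) (graphicalSquare M)
  graphicalSquare-isGraphicalHadamard M M-had Mᵀ-had =
    isHadamard-permuteColumns swapFactors↔ (⊗-isHadamard M-had Mᵀ-had) ,
    (λ i j → trans (graphicalSquare-entry M i j)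
             (trans (ℤP.*-comm (M (quotient n i) (remainder {n} n j)) _) (sym (graphicalSquare-entry M j i)))) ,
    (λ i j → trans (diagonal-one i) (sym (diagonal-one j)))
    where
    diagonal-one : ∀ i → graphicalSquare M i i ≡ + 1
    diagonal-one i = trans (graphicalSquare-entry M i i) (sign-square (proj₁ M-had _ _))

  graphicalSquare-equivalent : ∀ (M : Matrix n) →
    Equivalent (n ℕ.* n) (M ⊗ transpose M) (graphicalSquare M)
  graphicalSquare-equivalent M =
    ↔-id _ , swapFactors↔ , (λ _ → + 1) , (λ _ → + 1) , (λ _ → inj₁ refl) , (λ _ → inj₁ refl) ,
    λ i j → sym (ℤP.*-identityˡ (graphicalSquare M i j))

profileMoment-graphicalSquare : ∀ k {n} (M : Matrix n) {x} → 2 ∣ k →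
  profileMoment k M ≡ + x → profileMoment k (graphicalSquare M) ≡ + (x ℕ.* x)
profileMoment-graphicalSquare k M 2∣k M-m =
  trans (profileMoment-equivalent 2∣k (graphicalSquare-equivalent M))
        (profileMoment-⊗-+ k M (transpose M) M-m (trans (profileMoment-transpose k M) M-m))

decreasing : ∀ {N} (f : ℕ → ℕ) → (∀ k → suc k ≤ N → f (suc k) < f k) →
  ∀ {i j} → i < j → j ≤ N → f j < f i
decreasing f step {i} {suc j} i<1+j 1+j≤N with ℕP.m≤n⇒m<n∨m≡n (ℕP.m<1+n⇒m≤n i<1+j)
... | inj₁ i<j  = ℕP.<-trans (step j 1+j≤N) (decreasing f step i<j (ℕP.<⇒≤ 1+j≤N))
... | inj₂ refl = step i 1+j≤N

decreasing-injective : ∀ {N} (f : ℕ → ℕ) → (∀ k → suc k ≤ N → f (suc k) < f k) →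
  ∀ {i j} → i ≤ N → j ≤ N → f i ≡ f j → i ≡ j
decreasing-injective f step {i} {j} i≤N j≤N fi≡fj with ℕP.<-cmp i j
... | tri< i<j _ _ = ⊥-elim (ℕP.<-irrefl (sym fi≡fj) (decreasing f step i<j j≤N))
... | tri≈ _ i≡j _ = i≡j
... | tri> _ _ j<i = ⊥-elim (ℕP.<-irrefl fi≡fj (decreasing f step j<i i≤N))

module _ (a b : ℕ) where

  weight : ℕ → ℕ → ℕ
  weight zero    _       = 1
  weight (suc N) zero    = b ℕ.* weight N zero
  weight (suc N) (suc k) = a ℕ.* weight N k

  module _ (0<a : 0 < a) (a<b : a < b) where

    weight-nonZero : ∀ N k → NonZero (weight N k)
    weight-nonZero zero    k       = _
    weight-nonZero (suc N) zero    =
      ℕP.m*n≢0 b _ {{ℕ.>-nonZero (ℕP.<-trans 0<a a<b)}} {{weight-nonZero N zero}}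
    weight-nonZero (suc N) (suc k) =
      ℕP.m*n≢0 a _ {{ℕ.>-nonZero 0<a}} {{weight-nonZero N k}}

    weight-step : ∀ N k → suc k ≤ N → weight N (suc k) < weight N k
    weight-step (suc N) zero    _         = ℕP.*-monoˡ-< (weight N zero) {{weight-nonZero N zero}} a<b
    weight-step (suc N) (suc k) (s≤s k<N) = ℕP.*-monoʳ-< a {{ℕ.>-nonZero 0<a}} (weight-step N k k<N)

isSign? : ∀ x → Dec (IsSign x)
isSign? x = (x ℤ.≟ + 1) ⊎-dec (x ℤ.≟ -[1+ 0 ])

scaledId? : ∀ n i j x → Dec (scaledId n i j x)
scaledId? n i j x with i ≟ᶠ j
... | yes refl = map′ (λ x≡n → (λ _ → x≡n) , (λ i≢i → ⊥-elim (i≢i refl))) (λ diag → proj₁ diag refl) (x ℤ.≟ + n)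
... | no i≢j   = map′ (λ x≡0 → (λ i≡j → ⊥-elim (i≢j i≡j)) , (λ _ → x≡0)) (λ off → proj₂ off i≢j) (x ℤ.≟ + 0)

isHadamard? : ∀ n H → Dec (IsHadamard n H)
isHadamard? n H =
  all? (λ i → all? λ j → isSign? (H i j)) ×-dec
  all? (λ i → all? λ j → scaledId? n i j (rowDot H i j))

isGraphicalHadamard? : ∀ n H → Dec (IsGraphicalHadamard n H)
isGraphicalHadamard? n H =
  isHadamard? n H ×-dec
  all? (λ i → all? λ j → H i j ℤ.≟ H j i) ×-dec
  all? (λ i → all? λ j → H i i ℤ.≟ H j j)

I₁ : Matrix 1
I₁ _ _ = + 1

InequivalentGraphicalFamily : ℕ → ℕ → Set
InequivalentGraphicalFamily N n =
  Σ (Fin N → Matrix n) λ H →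
    ((a : Fin N) → IsGraphicalHadamard n (H a)) ×
    ((a b : Fin N) → a ≢ b → ¬ Equivalent n (H a) (H b))

module _ {n} (A B : Matrix n) where

  kroneckerWord : ∀ N → ℕ → Matrix (n ^ N)
  kroneckerWord zero    _       = I₁
  kroneckerWord (suc N) zero    = B ⊗ kroneckerWord N zero
  kroneckerWord (suc N) (suc k) = A ⊗ kroneckerWord N k

  kroneckerWord-isGraphicalHadamard : IsGraphicalHadamard n A → IsGraphicalHadamard n B →
    ∀ N k → IsGraphicalHadamard (n ^ N) (kroneckerWord N k)
  kroneckerWord-isGraphicalHadamard A-gr B-gr zero    k       = toWitness {a? = isGraphicalHadamard? 1 I₁} _
  kroneckerWord-isGraphicalHadamard A-gr B-gr (suc N) zero    =
    ⊗-isGraphicalHadamard B-gr (kroneckerWord-isGraphicalHadamard A-gr B-gr N zero)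
  kroneckerWord-isGraphicalHadamard A-gr B-gr (suc N) (suc k) =
    ⊗-isGraphicalHadamard A-gr (kroneckerWord-isGraphicalHadamard A-gr B-gr N k)

  profileMoment-kroneckerWord : ∀ {a b} → profileMoment 4 A ≡ + a → profileMoment 4 B ≡ + b →
    ∀ N k → profileMoment 4 (kroneckerWord N k) ≡ + weight a b N k
  profileMoment-kroneckerWord A-m B-m zero    k       = refl
  profileMoment-kroneckerWord A-m B-m (suc N) zero    =
    profileMoment-⊗-+ 4 B (kroneckerWord N zero) B-m (profileMoment-kroneckerWord A-m B-m N zero)
  profileMoment-kroneckerWord A-m B-m (suc N) (suc k) =
    profileMoment-⊗-+ 4 A (kroneckerWord N k) A-m (profileMoment-kroneckerWord A-m B-m N k)

  inequivalentFamily : ∀ {a b} → IsGraphicalHadamard n A → IsGraphicalHadamard n B →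
    profileMoment 4 A ≡ + a → profileMoment 4 B ≡ + b → 0 < a → a < b →
    ∀ N → InequivalentGraphicalFamily N (n ^ N)
  inequivalentFamily {a} {b} A-gr B-gr A-m B-m 0<a a<b N =
    kroneckerWord N ∘ toℕ , kroneckerWord-isGraphicalHadamard A-gr B-gr N ∘ toℕ , inequivalent
    where
    inequivalent : ∀ i j → i ≢ j → ¬ Equivalent (n ^ N) (kroneckerWord N (toℕ i)) (kroneckerWord N (toℕ j))
    inequivalent i j i≢j i~j =
      i≢j (toℕ-injective (decreasing-injective (weight a b N) (weight-step a b 0<a a<b N)
                            (ℕP.<⇒≤ (toℕ<n i)) (ℕP.<⇒≤ (toℕ<n j)) (ℤP.+-injective same-moment)))
      where
      same-moment : + weight a b N (toℕ i) ≡ + weight a b N (toℕ j)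
      same-moment = begin
        + weight a b N (toℕ i)                     ≡⟨ profileMoment-kroneckerWord A-m B-m N (toℕ i) ⟨
        profileMoment 4 (kroneckerWord N (toℕ i))  ≡⟨ profileMoment-equivalent {H = kroneckerWord N (toℕ i)} (divides 2 refl) i~j ⟨
        profileMoment 4 (kroneckerWord N (toℕ j))  ≡⟨ profileMoment-kroneckerWord A-m B-m N (toℕ j) ⟩
        + weight a b N (toℕ j)                     ∎

C₄ : Matrix 4
C₄ i j = if does (i ≟ᶠ j) then -[1+ 0 ] else + 1

-- The order is written 4 * 4 so
-- that graphicalSquare M₁₆ and graphicalSquare (C₄ ⊗ C₄) have syntactically equal orders:
-- otherwise the type checker evaluates profile moments to compare the two.
M₁₆ : Matrix (4 ℕ.* 4)
M₁₆ i j = lookup (lookup rows i) j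
  where
  p m : ℤ
  p = + 1
  m = -[1+ 0 ]
  rows : Vec (Vec ℤ 16) 16
  rows =
    (p ∷ p ∷ p ∷ p ∷ p ∷ p ∷ p ∷ p ∷ p ∷ p ∷ p ∷ p ∷ p ∷ p ∷ p ∷ p ∷ []) ∷
    (p ∷ m ∷ p ∷ m ∷ p ∷ m ∷ p ∷ m ∷ p ∷ m ∷ p ∷ m ∷ p ∷ m ∷ p ∷ m ∷ []) ∷
    (p ∷ p ∷ m ∷ m ∷ p ∷ p ∷ m ∷ m ∷ p ∷ p ∷ m ∷ m ∷ p ∷ p ∷ m ∷ m ∷ []) ∷
    (p ∷ m ∷ m ∷ p ∷ p ∷ m ∷ m ∷ p ∷ p ∷ m ∷ m ∷ p ∷ p ∷ m ∷ m ∷ p ∷ []) ∷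
    (p ∷ p ∷ p ∷ p ∷ m ∷ m ∷ m ∷ m ∷ p ∷ p ∷ p ∷ p ∷ m ∷ m ∷ m ∷ m ∷ []) ∷
    (p ∷ m ∷ p ∷ m ∷ m ∷ p ∷ m ∷ p ∷ p ∷ m ∷ p ∷ m ∷ m ∷ p ∷ m ∷ p ∷ []) ∷
    (p ∷ p ∷ m ∷ m ∷ m ∷ m ∷ p ∷ p ∷ p ∷ p ∷ m ∷ m ∷ m ∷ m ∷ p ∷ p ∷ []) ∷
    (p ∷ m ∷ m ∷ p ∷ m ∷ p ∷ p ∷ m ∷ p ∷ m ∷ m ∷ p ∷ m ∷ p ∷ p ∷ m ∷ []) ∷
    (p ∷ p ∷ p ∷ p ∷ p ∷ p ∷ p ∷ p ∷ m ∷ m ∷ m ∷ m ∷ m ∷ m ∷ m ∷ m ∷ []) ∷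
    (m ∷ p ∷ m ∷ m ∷ m ∷ p ∷ p ∷ p ∷ p ∷ m ∷ p ∷ p ∷ p ∷ m ∷ m ∷ m ∷ []) ∷
    (m ∷ m ∷ p ∷ p ∷ m ∷ p ∷ p ∷ m ∷ p ∷ p ∷ m ∷ m ∷ p ∷ m ∷ m ∷ p ∷ []) ∷
    (p ∷ m ∷ m ∷ m ∷ p ∷ p ∷ p ∷ m ∷ m ∷ p ∷ p ∷ p ∷ m ∷ m ∷ m ∷ p ∷ []) ∷
    (p ∷ m ∷ p ∷ m ∷ m ∷ p ∷ m ∷ p ∷ m ∷ p ∷ m ∷ p ∷ p ∷ m ∷ p ∷ m ∷ []) ∷
    (m ∷ m ∷ m ∷ p ∷ p ∷ p ∷ m ∷ p ∷ p ∷ p ∷ p ∷ m ∷ m ∷ m ∷ p ∷ m ∷ []) ∷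
    (m ∷ p ∷ p ∷ m ∷ p ∷ p ∷ m ∷ m ∷ p ∷ m ∷ m ∷ p ∷ m ∷ m ∷ p ∷ p ∷ []) ∷
    (p ∷ p ∷ m ∷ p ∷ m ∷ p ∷ m ∷ m ∷ m ∷ m ∷ p ∷ m ∷ p ∷ m ∷ p ∷ p ∷ []) ∷ []

C₄-isHadamard : IsHadamard 4 C₄
C₄-isHadamard = toWitness {a? = isHadamard? 4 C₄} _

C₄⊗C₄ᵀ-isHadamard : IsHadamard (4 ℕ.* 4) (transpose (C₄ ⊗ C₄))
C₄⊗C₄ᵀ-isHadamard = toWitness {a? = isHadamard? (4 ℕ.* 4) (transpose (C₄ ⊗ C₄))} _

M₁₆-isHadamard : IsHadamard (4 ℕ.* 4) M₁₆
M₁₆-isHadamard = toWitness {a? = isHadamard? (4 ℕ.* 4) M₁₆} _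

M₁₆ᵀ-isHadamard : IsHadamard (4 ℕ.* 4) (transpose M₁₆)
M₁₆ᵀ-isHadamard = toWitness {a? = isHadamard? (4 ℕ.* 4) (transpose M₁₆)} _

profileMoment-C₄ : profileMoment 4 C₄ ≡ + 16384
profileMoment-C₄ = refl

profileMoment-M₁₆ : profileMoment 4 M₁₆ ≡ + 155189248
profileMoment-M₁₆ = refl

inequivalentFamily₂₅₆ : ∀ N → InequivalentGraphicalFamily N (((4 ℕ.* 4) ℕ.* (4 ℕ.* 4)) ^ N)
inequivalentFamily₂₅₆ =
  inequivalentFamily (graphicalSquare M₁₆) (graphicalSquare (C₄ ⊗ C₄))
    (graphicalSquare-isGraphicalHadamard M₁₆ M₁₆-isHadamard M₁₆ᵀ-isHadamard)
    (graphicalSquare-isGraphicalHadamard (C₄ ⊗ C₄) (⊗-isHadamard C₄-isHadamard C₄-isHadamard) C₄⊗C₄ᵀ-isHadamard)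
    (profileMoment-graphicalSquare 4 M₁₆ (divides 2 refl) profileMoment-M₁₆)
    (profileMoment-graphicalSquare 4 (C₄ ⊗ C₄) (divides 2 refl)
      (profileMoment-⊗-+ 4 C₄ C₄ profileMoment-C₄ profileMoment-C₄))
    (ℕP.<ᵇ⇒< _ _ _) (ℕP.<ᵇ⇒< _ _ _)

corollary7p2 : (N : ℕ) → Σ ℕ λ m → Σ (Fin N → Matrix (4 ^ suc m)) λ H →
    ((a : Fin N) → IsGraphicalHadamard (4 ^ suc m) (H a)) ×
    ((a b : Fin N) → a ≢ b → ¬ Equivalent (4 ^ suc m) (H a) (H b))
corollary7p2 zero    = 0 , (λ ()) , (λ ()) , (λ ())
corollary7p2 (suc N) =
  3 ℕ.+ 4 ℕ.* N , subst (InequivalentGraphicalFamily (suc N)) 256^[1+N]≡4^[4+4N] (inequivalentFamily₂₅₆ (suc N))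
  where
  256^[1+N]≡4^[4+4N] : 256 ^ suc N ≡ 4 ^ (4 ℕ.+ 4 ℕ.* N)
  256^[1+N]≡4^[4+4N] = trans (ℕP.^-*-assoc 4 4 (suc N)) (cong (4 ^_) (ℕP.*-suc 4 N))
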